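{- Let $L\in\{\mathsf{NP},\mathsf{ND},\mathsf{NP4},\mathsf{ND4}\}$. Then for every modal formula $A$ the following are equivalent: (1) $L\vdash A$; (2) $A$ is valid in all $L$-frames; (3) $A$ is valid in all finite $L$-frames.
   Context: Let $\mathsf{MF}$ be the set of all modal propositional formulas. The pure logic of necessitation $\mathsf{N}$ is classical propositional logic (in the modal language) together with the necessitation rule: from $A$ infer $\Box A$. Define $\mathsf{NP}=\mathsf{N}+\neg\Box\bot$; $\mathsf{ND}=\mathsf{N}+\neg(\Box A\wedge\Box\neg A)$ (axiom scheme); $\mathsf{NP4}=\mathsf{NP}+(\Box A\to\Box\Box A)$; $\mathsf{ND4}=\mathsf{ND}+(\Box A\to\Box\Box A)$. An $\mathsf{N}$-frame is a tuple $(W,\{\prec_B\}_{B\in\mathsf{MF}})$ with $W$ non-empty and each $\prec_B$ a binary relation on $W$; it is finite if $W$ is finite. An $\mathsf{N}$-model adds a forcing relation $\Vdash$ satisfying the usual Boolean clauses and: $x\Vdash\Box B$ iff for all $y$, $x\prec_B y$ implies $y\Vdash B$. Validity in a model means forced at all worlds; validity in a frame means validity in all models on that frame. An $\mathsf{N}$-frame is an $\mathsf{NP}$-frame if every $x$ has some $y$ with $x\prec_\bot y$; an $\mathsf{ND}$-frame if for every $A\in\mathsf{MF}$ and $x\in W$ there is $y$ with $x\prec_A y$ and $x\prec_{\neg A} y$. It is transitive if for all $A\in\mathsf{MF}$ and $x,y,z\in W$, $x\prec_{\Box A}y$ and $y\prec_A z$ imply $x\prec_A z$. An $\mathsf{NP4}$-frame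 is a transitive $\mathsf{NP}$-frame, and an $\mathsf{ND4}$-frame is a transitive $\mathsf{ND}$-frame. "$L$-frame" refers to the corresponding class. -}

module Defs where

open import Data.Nat using (ℕ)
open import Data.Fin using (Fin)
open import Data.Bool using (Bool; true; false; not) renaming (_∧_ to _&&_; _∨_ to _||_)
open import Data.Product using (Σ; ∃; _×_; _,_)
open import Data.Sum using (_⊎_)
open import Relation.Binary.PropositionalEquality using (_≡_)
open import Function.Bundles using (_↔_; _⇔_)
open import Level using (Level; suc; zero)

infixr 5 _⇒_
infixr 6 _∨ᵐ_
infixr 7 _∧ᵐ_

data Fm : Set where
  var   : ℕ → Fm
  ⊥ᵐ    : Fm
  ¬ᵐ_   : Fm → Fm
  _∧ᵐ_  : Fm → Fm → Fm
  _∨ᵐ_  : Fm → Fm → Fm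
  _⇒_   : Fm → Fm → Fm
  □_    : Fm → Fm

-- Classical propositional logic in the modal language:
-- a tautology is a formula true under every Boolean assignment to its
-- propositional variables and to its (maximal) boxed subformulas.

evalPL : (Fm → Bool) → Fm → Bool
evalPL v (var p)   = v (var p)
evalPL v ⊥ᵐ        = false
evalPL v (¬ᵐ A)    = not (evalPL v A)
evalPL v (A ∧ᵐ B)  = evalPL v A && evalPL v B
evalPL v (A ∨ᵐ B)  = evalPL v A || evalPL v B
evalPL v (A ⇒ B)   = not (evalPL v A) || evalPL v B
evalPL v (□ A)     = v (□ A)

Tautology : Fm → Set
Tautology A = (v : Fm → Bool) → evalPL v A ≡ true

data Logic : Set where
  NP ND NP4 ND4 : Logic

AxP : Fm → Set
AxP A = A ≡ ¬ᵐ (□ ⊥ᵐ)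

AxD : Fm → Set
AxD A = ∃ λ B → A ≡ ¬ᵐ ((□ B) ∧ᵐ (□ (¬ᵐ B)))

Ax4 : Fm → Set
Ax4 A = ∃ λ B → A ≡ ((□ B) ⇒ (□ (□ B)))

ExtraAx : Logic → Fm → Set
ExtraAx NP  A = AxP A
ExtraAx ND  A = AxD A
ExtraAx NP4 A = AxP A ⊎ Ax4 A
ExtraAx ND4 A = AxD A ⊎ Ax4 A

data _⊢_ (L : Logic) : Fm → Set where
  taut : ∀ {A} → Tautology A → L ⊢ A
  ax   : ∀ {A} → ExtraAx L A → L ⊢ A
  mp   : ∀ {A B} → L ⊢ (A ⇒ B) → L ⊢ A → L ⊢ B
  nec  : ∀ {A} → L ⊢ A → L ⊢ (□ A)

record Frame : Set₁ where
  field
    W    : Set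
    w₀   : W                      -- W is non-empty
    R    : Fm → W → W → Set       -- R B x y  means  x ≺_B y

-- A forcing relation on a frame (Boolean-valued: x ⊩ A iff force x A ≡ true)
record IsForcing (F : Frame) (force : Frame.W F → Fm → Bool) : Set where
  open Frame F
  field
    f-⊥  : ∀ x → force x ⊥ᵐ ≡ false
    f-¬  : ∀ x A → force x (¬ᵐ A) ≡ not (force x A)
    f-∧  : ∀ x A B → force x (A ∧ᵐ B) ≡ (force x A && force x B)
    f-∨  : ∀ x A B → force x (A ∨ᵐ B) ≡ (force x A || force x B)
    f-⇒  : ∀ x A B → force x (A ⇒ B) ≡ (not (force x A) || force x B)
    f-□  : ∀ x B → (force x (□ B) ≡ true) ⇔ (∀ y → R B x y → force y B ≡ true)

record Model (F : Frame) : Set where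
  field
    force     : Frame.W F → Fm → Bool
    isForcing : IsForcing F force

ValidInModel : {F : Frame} → Model F → Fm → Set
ValidInModel {F} M A = ∀ (x : Frame.W F) → Model.force M x A ≡ true

ValidInFrame : Frame → Fm → Set
ValidInFrame F A = (M : Model F) → ValidInModel M A

Finite : Frame → Set
Finite F = Σ ℕ λ n → Frame.W F ↔ Fin n

IsNPFrame : Frame → Set
IsNPFrame F = ∀ (x : W) → ∃ λ y → R ⊥ᵐ x y
  where open Frame F

IsNDFrame : Frame → Set
IsNDFrame F = ∀ (A : Fm) (x : W) → ∃ λ y → R A x y × R (¬ᵐ A) x y
  where open Frame F

IsTransitive : Frame → Set
IsTransitive F = ∀ (A : Fm) (x y z : W) → R (□ A) x y → R A y z → R A x z
  where open Frame F

IsLFrame : Logic → Frame → Set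
IsLFrame NP  F = IsNPFrame F
IsLFrame ND  F = IsNDFrame F
IsLFrame NP4 F = IsNPFrame F × IsTransitive F
IsLFrame ND4 F = IsNDFrame F × IsTransitive F

ValidAllLFrames : Logic → Fm → Set₁
ValidAllLFrames L A = (F : Frame) → IsLFrame L F → ValidInFrame F A

ValidFiniteLFrames : Logic → Fm → Set₁
ValidFiniteLFrames L A = (F : Frame) → Finite F → IsLFrame L F → ValidInFrame F A

-- Soundness is a routine induction on derivations. For completeness, recursion
-- on modal depth decides every A: it yields either a derivation of A or a
-- finite countermodel.
--
-- Let Φ be the subformulas of A and Θ a finite list of L-theorems whose atoms
-- (variables and boxed formulas) lie in Φ: □B whenever L ⊢ B, and for the
-- D-logics ¬□B whenever L ⊢ ¬B (decided by recursion, since □B ∈ Φ makes B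
-- shallower than A), together with the instances over Φ of the axioms of L
-- and, for ND4, of ¬(□B ∧ □¬□B). If every Boolean valuation of Φ satisfying Θ
-- satisfies A, then A is a tautological consequence of Θ, hence derivable.
-- Otherwise these valuations are the worlds of a finite L-model refuting A,
-- where x ≺_B y iff □B ∈ x implies B ∈ y and, for the transitive logics,
-- every boxed D ∈ x with B = □ⁿD (n ≥ 0) lies in y. As the relation depends on
-- B, a world x with □B ∉ x needs just one ≺_B-successor refuting B; it is read
-- off from the countermodel of B produced by the recursion.

{-# OPTIONS --safe #-}
module Submission where

open import Defs
open import Data.Bool using (Bool; true; false; not; if_then_else_) renaming (_∧_ to _&&_; _∨_ to _||_)
open import Data.Bool.Properties using (¬-not; not-¬) renaming (_≟_ to _≟ᵇ_)
open import Data.Empty using (⊥; ⊥-elim)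
open import Data.Fin using (Fin)
open import Data.Fin.Properties using (all?; any?; 2↔Bool)
open import Data.List using (List; []; _∷_; _++_; length; concat; map)
open import Data.List.Membership.Propositional using (_∈_; mapWith∈)
open import Data.List.Membership.Propositional.Properties using (∈-++⁺ˡ; ∈-++⁺ʳ; ∈-++⁻)
open import Data.List.Relation.Binary.Subset.Propositional using (_⊆_)
open import Data.List.Relation.Unary.All as All using (All; []; _∷_)
open import Data.List.Relation.Unary.All.Properties using (++⁻; concat⁻; map⁺; map⁻)
open import Data.List.Relation.Unary.Any using (here; there)
open import Data.Nat as ℕ using (ℕ; suc; _<_; _≤_; _⊔_)
open import Data.Nat.Induction using (<-wellFounded)
open import Data.Nat.Properties using (≤-refl; ≤-trans; m≤m⊔n; m≤n⊔m; m≤n⇒m≤1+n)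
open import Data.Product using (∃; _×_; _,_; proj₁; proj₂; uncurry)
open import Data.Sum using (_⊎_; inj₁; inj₂; fromInj₁)
open import Data.Unit using (⊤; tt)
open import Data.Vec using (Vec; []; _∷_)
open import Data.Vec.Recursive using (Fin[m^n]↔Fin[m]^n; lift↔)
open import Data.Vec.Recursive.Properties using (↔Vec)
open import Function using (_∘_; id; const)
open import Function.Bundles using (_⇔_; _↔_; mk⇔; Equivalence; Inverse)
open import Function.Properties.Inverse using (↔-sym; ↔-trans)
open import Induction.WellFounded as WF using ()
open import Relation.Binary.Construct.On as On using ()
open import Relation.Binary.Definitions using (DecidableEquality)
open import Relation.Binary.PropositionalEquality
open import Relation.Nullary using (Dec; yes; no; does; ¬_; map′; _×-dec_; _→-dec_)
open import Relation.Nullary.Decidable using (dec-true; dec-false)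
open import Relation.Unary using (Decidable)

∧≡true : ∀ {a b} → (a && b) ≡ true → a ≡ true × b ≡ true
∧≡true {true} b≡true = refl , b≡true

⇒≡true⁺ : ∀ {a b} → (a ≡ true → b ≡ true) → (not a || b) ≡ true
⇒≡true⁺ {true}  h = h refl
⇒≡true⁺ {false} h = refl

⇒≡true⁻ : ∀ {a b} → (not a || b) ≡ true → a ≡ true → b ≡ true
⇒≡true⁻ h refl = h

not≡true : ∀ {b} → not b ≡ true → b ≡ false
not≡true {false} _ = refl

not≡false : ∀ {b} → not b ≡ false → b ≡ true
not≡false {true} _ = refl

refute : ∀ {b} {P : Set} → b ≡ false → b ≡ true → P
refute b≡false b≡true = ⊥-elim (not-¬ b≡true b≡false)

does⇔ : ∀ {P : Set} (P? : Dec P) → does P? ≡ true ⇔ P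
does⇔ (yes p) = mk⇔ (const p) (const refl)
does⇔ (no ¬p) = mk⇔ (λ ()) (⊥-elim ∘ ¬p)

module _ {W : Set} {k : ℕ} (enum : W ↔ Fin k) {P : W → Set} (P? : Decidable P) where
  open Inverse enum

  ∀? : Dec (∀ x → P x)
  ∀? = map′ (λ h x → subst P (strictlyInverseʳ x) (h (to x))) (λ h → h ∘ from)
            (all? (P? ∘ from))

  ∃? : Dec (∃ P)
  ∃? = map′ (λ (i , p) → from i , p) (λ (x , p) → to x , subst P (sym (strictlyInverseʳ x)) p)
            (any? (P? ∘ from))

vec↔fin : ∀ n → Vec Bool n ↔ Fin (2 ℕ.^ n)
vec↔fin n = ↔-sym (↔-trans (Fin[m^n]↔Fin[m]^n 2 n) (↔-trans (lift↔ n 2↔Bool) (↔Vec n)))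

lookup-mapWith∈ : ∀ {A B : Set} {P : B → Set} {x} (xs : List A) {f : ∀ {y} → y ∈ xs → B} →
                  All P (mapWith∈ xs f) → (m : x ∈ xs) → P (f m)
lookup-mapWith∈ (_ ∷ _)  (p ∷ _)  (here refl) = p
lookup-mapWith∈ (_ ∷ xs) (_ ∷ ps) (there m)   = lookup-mapWith∈ xs ps m

shape : Fm → ℕ
shape (var _)  = 0
shape ⊥ᵐ       = 1
shape (¬ᵐ _)   = 2
shape (_ ∧ᵐ _) = 3
shape (_ ∨ᵐ _) = 4
shape (_ ⇒ _)  = 5
shape (□ _)    = 6

infix 4 _≟_
_≟_ : DecidableEquality Fm
≟-sameShape : ∀ A B → shape A ≡ shape B → Dec (A ≡ B)

A ≟ B with shape A ℕ.≟ shape B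
... | yes same = ≟-sameShape A B same
... | no  diff = no (diff ∘ cong shape)

-- The pairs of distinct constructors need no clauses: matching on refl refutes them.
≟-sameShape (var p)  (var q)  refl = map′ (cong var) (λ { refl → refl }) (p ℕ.≟ q)
≟-sameShape ⊥ᵐ       ⊥ᵐ       refl = yes refl
≟-sameShape (¬ᵐ A)   (¬ᵐ B)   refl = map′ (cong ¬ᵐ_) (λ { refl → refl }) (A ≟ B)
≟-sameShape (A ∧ᵐ B) (C ∧ᵐ D) refl =
  map′ (uncurry (cong₂ _∧ᵐ_)) (λ { refl → refl , refl }) (A ≟ C ×-dec B ≟ D)
≟-sameShape (A ∨ᵐ B) (C ∨ᵐ D) refl =
  map′ (uncurry (cong₂ _∨ᵐ_)) (λ { refl → refl , refl }) (A ≟ C ×-dec B ≟ D)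
≟-sameShape (A ⇒ B)  (C ⇒ D)  refl =
  map′ (uncurry (cong₂ _⇒_)) (λ { refl → refl , refl }) (A ≟ C ×-dec B ≟ D)
≟-sameShape (□ A)    (□ B)    refl = map′ (cong □_) (λ { refl → refl }) (A ≟ B)

open import Data.List.Membership.DecPropositional _≟_ using (_∈?_)

subformulas properSubformulas : Fm → List Fm
subformulas A = A ∷ properSubformulas A

properSubformulas (var _)  = []
properSubformulas ⊥ᵐ       = []
properSubformulas (¬ᵐ A)   = subformulas A
properSubformulas (A ∧ᵐ B) = subformulas A ++ subformulas B
properSubformulas (A ∨ᵐ B) = subformulas A ++ subformulas B
properSubformulas (A ⇒ B)  = subformulas A ++ subformulas B
properSubformulas (□ A)    = subformulas A

⊆-subformulas : ∀ {A B} → A ∈ subformulas B → subformulas A ⊆ subformulas B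
⊆-subformulas-++ : ∀ {A} B C → A ∈ subformulas B ++ subformulas C →
                   subformulas A ⊆ subformulas B ++ subformulas C

⊆-subformulas (here refl) = id
⊆-subformulas {B = ¬ᵐ B}   (there m) = there ∘ ⊆-subformulas m
⊆-subformulas {B = B ∧ᵐ C} (there m) = there ∘ ⊆-subformulas-++ B C m
⊆-subformulas {B = B ∨ᵐ C} (there m) = there ∘ ⊆-subformulas-++ B C m
⊆-subformulas {B = B ⇒ C}  (there m) = there ∘ ⊆-subformulas-++ B C m
⊆-subformulas {B = □ B}    (there m) = there ∘ ⊆-subformulas m

⊆-subformulas-++ B C m with ∈-++⁻ (subformulas B) m
... | inj₁ mB = ∈-++⁺ˡ ∘ ⊆-subformulas mB
... | inj₂ mC = ∈-++⁺ʳ (subformulas B) ∘ ⊆-subformulas mC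

depth : Fm → ℕ
depth (var _)  = 0
depth ⊥ᵐ       = 0
depth (¬ᵐ A)   = depth A
depth (A ∧ᵐ B) = depth A ⊔ depth B
depth (A ∨ᵐ B) = depth A ⊔ depth B
depth (A ⇒ B)  = depth A ⊔ depth B
depth (□ A)    = suc (depth A)

depth-subformula : ∀ {A B} → A ∈ subformulas B → depth A ≤ depth B
depth-subformula-++ : ∀ {A} B C → A ∈ subformulas B ++ subformulas C → depth A ≤ depth B ⊔ depth C

depth-subformula (here refl) = ≤-refl
depth-subformula {B = ¬ᵐ B}   (there m) = depth-subformula m
depth-subformula {B = B ∧ᵐ C} (there m) = depth-subformula-++ B C m
depth-subformula {B = B ∨ᵐ C} (there m) = depth-subformula-++ B C m
depth-subformula {B = B ⇒ C}  (there m) = depth-subformula-++ B C m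
depth-subformula {B = □ B}    (there m) = m≤n⇒m≤1+n (depth-subformula m)

depth-subformula-++ B C m with ∈-++⁻ (subformulas B) m
... | inj₁ mB = ≤-trans (depth-subformula mB) (m≤m⊔n (depth B) (depth C))
... | inj₂ mC = ≤-trans (depth-subformula mC) (m≤n⊔m (depth B) (depth C))

boxTails : Fm → List Fm
boxTails (□ A) = □ A ∷ boxTails A
boxTails _     = []

AtomsIn : List Fm → Fm → Set
AtomsIn Φ (var p)  = var p ∈ Φ
AtomsIn Φ ⊥ᵐ       = ⊤
AtomsIn Φ (¬ᵐ A)   = AtomsIn Φ A
AtomsIn Φ (A ∧ᵐ B) = AtomsIn Φ A × AtomsIn Φ B
AtomsIn Φ (A ∨ᵐ B) = AtomsIn Φ A × AtomsIn Φ B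
AtomsIn Φ (A ⇒ B)  = AtomsIn Φ A × AtomsIn Φ B
AtomsIn Φ (□ A)    = □ A ∈ Φ

atomsIn : ∀ {Φ} A → subformulas A ⊆ Φ → AtomsIn Φ A
atomsIn (var p)  s = s (here refl)
atomsIn ⊥ᵐ       s = tt
atomsIn (¬ᵐ A)   s = atomsIn A (λ m → s (there m))
atomsIn (A ∧ᵐ B) s = atomsIn A (λ m → s (there (∈-++⁺ˡ m)))
                   , atomsIn B (λ m → s (there (∈-++⁺ʳ (subformulas A) m)))
atomsIn (A ∨ᵐ B) s = atomsIn A (λ m → s (there (∈-++⁺ˡ m)))
                   , atomsIn B (λ m → s (there (∈-++⁺ʳ (subformulas A) m)))
atomsIn (A ⇒ B)  s = atomsIn A (λ m → s (there (∈-++⁺ˡ m)))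
                   , atomsIn B (λ m → s (there (∈-++⁺ʳ (subformulas A) m)))
atomsIn (□ A)    s = s (here refl)

evalPL-cong : ∀ {Φ v v′} A → AtomsIn Φ A → (∀ {B} → B ∈ Φ → v B ≡ v′ B) →
              evalPL v A ≡ evalPL v′ A
evalPL-cong (var p)  a       agree = agree a
evalPL-cong ⊥ᵐ       _       agree = refl
evalPL-cong (¬ᵐ A)   a       agree = cong not (evalPL-cong A a agree)
evalPL-cong (A ∧ᵐ B) (a , b) agree = cong₂ _&&_ (evalPL-cong A a agree) (evalPL-cong B b agree)
evalPL-cong (A ∨ᵐ B) (a , b) agree = cong₂ _||_ (evalPL-cong A a agree) (evalPL-cong B b agree)
evalPL-cong (A ⇒ B)  (a , b) agree =
  cong₂ (λ x y → not x || y) (evalPL-cong A a agree) (evalPL-cong B b agree)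
evalPL-cong (□ A)    a       agree = agree a

-- Formulas outside Φ are false.
valuation : (Φ : List Fm) → Vec Bool (length Φ) → Fm → Bool
valuation []      []      A = false
valuation (B ∷ Φ) (b ∷ w) A = if does (A ≟ B) then b else valuation Φ w A

restrict : (Φ : List Fm) → (Fm → Bool) → Vec Bool (length Φ)
restrict []      v = []
restrict (B ∷ Φ) v = v B ∷ restrict Φ v

valuation-restrict : ∀ Φ {v A} → A ∈ Φ → valuation Φ (restrict Φ v) A ≡ v A
valuation-restrict (B ∷ Φ) {A = A} m with A ≟ B | m
... | yes refl | _         = refl
... | no  A≢B  | here A≡B = ⊥-elim (A≢B A≡B)
... | no  _    | there m′  = valuation-restrict Φ m′

valuation-∈ : ∀ Φ w {A} → valuation Φ w A ≡ true → A ∈ Φ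
valuation-∈ []      []      ()
valuation-∈ (B ∷ Φ) (b ∷ w) {A} h with A ≟ B
... | yes A≡B = here A≡B
... | no  _   = there (valuation-∈ Φ w h)

infixr 5 _⇒*_
_⇒*_ : List Fm → Fm → Fm
[]      ⇒* C = C
(θ ∷ Γ) ⇒* C = θ ⇒ (Γ ⇒* C)

⇒*≡true : ∀ {v C} Γ → (All (λ θ → evalPL v θ ≡ true) Γ → evalPL v C ≡ true) →
          evalPL v (Γ ⇒* C) ≡ true
⇒*≡true []      h = h []
⇒*≡true (θ ∷ Γ) h = ⇒≡true⁺ λ θ≡true → ⇒*≡true Γ (λ hs → h (θ≡true ∷ hs))

mp* : ∀ {L C} Γ → L ⊢ (Γ ⇒* C) → All (L ⊢_) Γ → L ⊢ C
mp* []      ⊢C   []         = ⊢C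
mp* (θ ∷ Γ) ⊢Γ⇒C (⊢θ ∷ ⊢Γ) = mp* Γ (mp ⊢Γ⇒C ⊢θ) ⊢Γ

module _ {F : Frame} (M : Model F) where
  open Frame F
  open Model M
  open IsForcing isForcing

  evalPL-force : ∀ x A → evalPL (force x) A ≡ force x A
  evalPL-force x (var p)  = refl
  evalPL-force x ⊥ᵐ       = sym (f-⊥ x)
  evalPL-force x (¬ᵐ A)   = trans (cong not (evalPL-force x A)) (sym (f-¬ x A))
  evalPL-force x (A ∧ᵐ B) = trans (cong₂ _&&_ (evalPL-force x A) (evalPL-force x B)) (sym (f-∧ x A B))
  evalPL-force x (A ∨ᵐ B) = trans (cong₂ _||_ (evalPL-force x A) (evalPL-force x B)) (sym (f-∨ x A B))
  evalPL-force x (A ⇒ B)  =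
    trans (cong₂ (λ a b → not a || b) (evalPL-force x A) (evalPL-force x B)) (sym (f-⇒ x A B))
  evalPL-force x (□ A)    = refl

  tautology-valid : ∀ {A} → Tautology A → ValidInModel M A
  tautology-valid {A} t x = trans (sym (evalPL-force x A)) (t (force x))

  mp-valid : ∀ {A B} → ValidInModel M (A ⇒ B) → ValidInModel M A → ValidInModel M B
  mp-valid {A} {B} ⊨A⇒B ⊨A x = ⇒≡true⁻ (trans (sym (f-⇒ x A B)) (⊨A⇒B x)) (⊨A x)

  nec-valid : ∀ {A} → ValidInModel M A → ValidInModel M (□ A)
  nec-valid {A} ⊨A x = Equivalence.from (f-□ x A) (λ y _ → ⊨A y)

  P-valid : IsNPFrame F → ValidInModel M (¬ᵐ □ ⊥ᵐ)
  P-valid serial x = trans (f-¬ x (□ ⊥ᵐ)) (cong not (¬-not □⊥-unforced))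
    where
    □⊥-unforced : force x (□ ⊥ᵐ) ≢ true
    □⊥-unforced ⊩□⊥ = let y , x≺y = serial x in
      not-¬ (Equivalence.to (f-□ x ⊥ᵐ) ⊩□⊥ y x≺y) (f-⊥ y)

  D-valid : IsNDFrame F → ∀ B → ValidInModel M (¬ᵐ (□ B ∧ᵐ □ ¬ᵐ B))
  D-valid nd B x = trans (f-¬ x _) (cong not (trans (f-∧ x _ _) (¬-not both-unforced)))
    where
    both-unforced : (force x (□ B) && force x (□ ¬ᵐ B)) ≢ true
    both-unforced h with ∧≡true h | nd B x
    ... | ⊩□B , ⊩□¬B | y , x≺y , x≺′y =
      not-¬ (Equivalence.to (f-□ x B) ⊩□B y x≺y)
            (not≡true (trans (sym (f-¬ y B)) (Equivalence.to (f-□ x (¬ᵐ B)) ⊩□¬B y x≺′y)))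

  4-valid : IsTransitive F → ∀ B → ValidInModel M (□ B ⇒ □ □ B)
  4-valid tr B x = trans (f-⇒ x _ _) (⇒≡true⁺ λ ⊩□B →
    Equivalence.from (f-□ x (□ B)) λ y x≺y → Equivalence.from (f-□ y B) λ z y≺z →
      Equivalence.to (f-□ x B) ⊩□B z (tr B x y z x≺y y≺z))

extraAx-valid : ∀ {L A F} → ExtraAx L A → IsLFrame L F → ValidInFrame F A
extraAx-valid {NP}  refl              serial       M = P-valid M serial
extraAx-valid {ND}  (B , refl)        nd           M = D-valid M nd B
extraAx-valid {NP4} (inj₁ refl)       (serial , _) M = P-valid M serial
extraAx-valid {NP4} (inj₂ (B , refl)) (_ , tr)     M = 4-valid M tr B
extraAx-valid {ND4} (inj₁ (B , refl)) (nd , _)     M = D-valid M nd B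
extraAx-valid {ND4} (inj₂ (B , refl)) (_ , tr)     M = 4-valid M tr B

sound : ∀ {L A} → L ⊢ A → ValidAllLFrames L A
sound (taut t) F isL M = tautology-valid M t
sound (ax a)   F isL M = extraAx-valid a isL M
sound (mp d e) F isL M = mp-valid M (sound d F isL M) (sound e F isL M)
sound (nec d)  F isL M = nec-valid M (sound d F isL M)

data HasP : Logic → Set where
  P∈NP  : HasP NP
  P∈NP4 : HasP NP4

data HasD : Logic → Set where
  D∈ND  : HasD ND
  D∈ND4 : HasD ND4

data Has4 : Logic → Set where
  4∈NP4 : Has4 NP4
  4∈ND4 : Has4 ND4

hasP? : ∀ L → Dec (HasP L)
hasP? NP  = yes P∈NP
hasP? ND  = no λ ()
hasP? NP4 = yes P∈NP4
hasP? ND4 = no λ ()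

hasD? : ∀ L → Dec (HasD L)
hasD? NP  = no λ ()
hasD? ND  = yes D∈ND
hasD? NP4 = no λ ()
hasD? ND4 = yes D∈ND4

has4? : ∀ L → Dec (Has4 L)
has4? NP  = no λ ()
has4? ND  = no λ ()
has4? NP4 = yes 4∈NP4
has4? ND4 = yes 4∈ND4

axP : ∀ {L} → HasP L → L ⊢ (¬ᵐ □ ⊥ᵐ)
axP P∈NP  = ax refl
axP P∈NP4 = ax (inj₁ refl)

axD : ∀ {L} → HasD L → ∀ B → L ⊢ (¬ᵐ (□ B ∧ᵐ □ ¬ᵐ B))
axD D∈ND  B = ax (B , refl)
axD D∈ND4 B = ax (inj₁ (B , refl))

ax4 : ∀ {L} → Has4 L → ∀ B → L ⊢ (□ B ⇒ □ □ B)
ax4 4∈NP4 B = ax (inj₂ (B , refl))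
ax4 4∈ND4 B = ax (inj₂ (B , refl))

isLFrame : ∀ L {F} → (HasP L → IsNPFrame F) → (HasD L → IsNDFrame F) →
           (Has4 L → IsTransitive F) → IsLFrame L F
isLFrame NP  np nd tr = np P∈NP
isLFrame ND  np nd tr = nd D∈ND
isLFrame NP4 np nd tr = np P∈NP4 , tr 4∈NP4
isLFrame ND4 np nd tr = nd D∈ND4 , tr 4∈ND4

D-rule : ∀ {L B} → HasD L → L ⊢ (¬ᵐ B) → L ⊢ (¬ᵐ □ B)
D-rule {B = B} hasD ⊢¬B = mp (mp (taut t) (nec ⊢¬B)) (axD hasD B)
  where
  t : Tautology (□ ¬ᵐ B ⇒ ¬ᵐ (□ B ∧ᵐ □ ¬ᵐ B) ⇒ ¬ᵐ □ B)
  t v with v (□ ¬ᵐ B) | v (□ B)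
  ... | false | _     = refl
  ... | true  | false = refl
  ... | true  | true  = refl

D4-theorem : ∀ {L} → HasD L → Has4 L → ∀ B → L ⊢ (¬ᵐ (□ B ∧ᵐ □ ¬ᵐ □ B))
D4-theorem hasD has4 B = mp (mp (taut t) (ax4 has4 B)) (axD hasD (□ B))
  where
  t : Tautology ((□ B ⇒ □ □ B) ⇒ ¬ᵐ (□ □ B ∧ᵐ □ ¬ᵐ □ B) ⇒
                 ¬ᵐ (□ B ∧ᵐ □ ¬ᵐ □ B))
  t v with v (□ B) | v (□ □ B) | v (□ ¬ᵐ □ B)
  ... | false | false | false = refl
  ... | false | false | true  = refl
  ... | false | true  | false = refl
  ... | false | true  | true  = refl
  ... | true  | false | _     = refl
  ... | true  | true  | false = refl
  ... | true  | true  | true  = refl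

record Countermodel (L : Logic) (A : Fm) : Set₁ where
  field
    frame   : Frame
    isL     : IsLFrame L frame
    finite  : Finite frame
    model   : Model frame
    world   : Frame.W frame
    refutes : Model.force model world A ≡ false

  invalid : ¬ ValidFiniteLFrames L A
  invalid valid = not-¬ (valid frame finite isL model world) refutes

  unprovable : ¬ (L ⊢ A)
  unprovable ⊢A = invalid (λ F _ → sound ⊢A F)

Decided : Logic → Fm → Set₁
Decided L A = L ⊢ A ⊎ Countermodel L A

provable? : ∀ {L A} → Decided L A → Dec (L ⊢ A)
provable? (inj₁ ⊢A) = yes ⊢A
provable? (inj₂ cm) = no (Countermodel.unprovable cm)

module FiniteModel (F : Frame) {k : ℕ} (enum : Frame.W F ↔ Fin k)
                   (R? : ∀ B x y → Dec (Frame.R F B x y)) (atom : Frame.W F → ℕ → Bool) where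
  open Frame F

  force : W → Fm → Bool
  successors-force? : ∀ x B → Dec (∀ y → R B x y → force y B ≡ true)

  force x (var p)  = atom x p
  force x ⊥ᵐ       = false
  force x (¬ᵐ A)   = not (force x A)
  force x (A ∧ᵐ B) = force x A && force x B
  force x (A ∨ᵐ B) = force x A || force x B
  force x (A ⇒ B)  = not (force x A) || force x B
  force x (□ B)    = does (successors-force? x B)

  successors-force? x B = ∀? enum λ y → R? B x y →-dec force y B ≟ᵇ true

  model : Model F
  model = record
    { force     = force
    ; isForcing = record
      { f-⊥ = λ _ → refl
      ; f-¬ = λ _ _ → refl
      ; f-∧ = λ _ _ _ → refl
      ; f-∨ = λ _ _ _ → refl
      ; f-⇒ = λ _ _ _ → refl
      ; f-□ = λ x B → does⇔ (successors-force? x B)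
      }
    }

module ValuationFrame (L : Logic) {W : Set} {k : ℕ} (enum : W ↔ Fin k) (w₀ : W)
                      (⟦_⟧ : W → Fm → Bool) where

  infix 4 _⊨_ _⊭_
  _⊨_ _⊭_ : W → Fm → Set
  x ⊨ A = evalPL ⟦ x ⟧ A ≡ true
  x ⊭ A = evalPL ⟦ x ⟧ A ≡ false

  Persist : W → Fm → W → Set
  Persist x B y = All (λ D → x ⊨ D → y ⊨ D) (boxTails B)

  Access : Fm → W → W → Set
  Access B x y = (x ⊨ □ B → y ⊨ B) × (Has4 L → Persist x B y)

  persist-refl : ∀ {x} B → Persist x B x
  persist-refl B = All.universal (λ _ → id) (boxTails B)

  frame : Frame
  frame = record { W = W ; w₀ = w₀ ; R = Access }

  isTransitive : Has4 L → IsTransitive frame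
  isTransitive has4 A x y z (_ , x↝y) (y→z , y↝z) =
    y→z ∘ All.head (x↝y has4) ,
    λ has4′ → All.zipWith (λ (x→y , y→z) → y→z ∘ x→y)
                          (All.tail (x↝y has4′) , y↝z has4′)

  access? : ∀ B x y → Dec (Access B x y)
  access? B x y =
    (x ⊨? □ B →-dec y ⊨? B) ×-dec
    (has4? L →-dec All.all? (λ D → x ⊨? D →-dec y ⊨? D) (boxTails B))
    where
    infix 4 _⊨?_
    _⊨?_ : ∀ w A → Dec (w ⊨ A)
    w ⊨? A = evalPL ⟦ w ⟧ A ≟ᵇ true

  open FiniteModel frame enum access? (λ x p → ⟦ x ⟧ (var p)) public

  Witnessed : Fm → Set
  Witnessed E = ∀ x → x ⊭ □ E → ∃ λ y → Access E x y × y ⊭ E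

  truth : ∀ A → (∀ {E} → □ E ∈ subformulas A → Witnessed E) →
          ∀ x → force x A ≡ evalPL ⟦ x ⟧ A
  truth (var p)  ws x = refl
  truth ⊥ᵐ       ws x = refl
  truth (¬ᵐ A)   ws x = cong not (truth A (λ m → ws (there m)) x)
  truth (A ∧ᵐ B) ws x = cong₂ _&&_ (truth A (λ m → ws (there (∈-++⁺ˡ m))) x)
                                   (truth B (λ m → ws (there (∈-++⁺ʳ (subformulas A) m))) x)
  truth (A ∨ᵐ B) ws x = cong₂ _||_ (truth A (λ m → ws (there (∈-++⁺ˡ m))) x)
                                   (truth B (λ m → ws (there (∈-++⁺ʳ (subformulas A) m))) x)
  truth (A ⇒ B)  ws x = cong₂ (λ a b → not a || b)
                          (truth A (λ m → ws (there (∈-++⁺ˡ m))) x)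
                          (truth B (λ m → ws (there (∈-++⁺ʳ (subformulas A) m))) x)
  truth (□ E)    ws x = □-case _ refl
    where
    truthE : ∀ y → force y E ≡ evalPL ⟦ y ⟧ E
    truthE = truth E (λ m → ws (there m))

    □-case : ∀ b → ⟦ x ⟧ (□ E) ≡ b → force x (□ E) ≡ b
    □-case true  x⊨□E = dec-true (successors-force? x E) λ y (x→y , _) →
      trans (truthE y) (x→y x⊨□E)
    □-case false x⊭□E = dec-false (successors-force? x E) λ all-y →
      let y , x≺y , y⊭E = ws (here refl) x x⊭□E in
      not-¬ (trans (sym (truthE y)) (all-y y x≺y)) y⊭E

module Decide (L : Logic) (C : Fm) (IH : ∀ B → depth B < depth C → Decided L B) where

  Φ : List Fm
  Φ = subformulas C

  unbox∈Φ : ∀ {B} → □ B ∈ Φ → B ∈ Φ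
  unbox∈Φ m = ⊆-subformulas m (there (here refl))

  unneg∈Φ : ∀ {B} → ¬ᵐ B ∈ Φ → B ∈ Φ
  unneg∈Φ m = ⊆-subformulas m (there (here refl))

  atomsInΦ : ∀ {A} → A ∈ Φ → AtomsIn Φ A
  atomsInΦ m = atomsIn _ (⊆-subformulas m)

  depth-< : ∀ {B} → □ B ∈ Φ → depth B < depth C
  depth-< = depth-subformula

  record Law : Set where
    constructor law
    field
      formula   : Fm
      derivable : L ⊢ formula
      atoms     : AtomsIn Φ formula
  open Law

  lawIf : {P : Set} → Dec P → (θ : Fm) → (P → L ⊢ θ × AtomsIn Φ θ) → List Law
  lawIf (yes p) θ f = law θ (proj₁ (f p)) (proj₂ (f p)) ∷ []
  lawIf (no _)  θ f = []

  Holds : (Fm → Bool) → Law → Set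
  Holds v ℓ = evalPL v (formula ℓ) ≡ true

  lawIf-holds : ∀ {P v θ f} (P? : Dec P) → P → All (Holds v) (lawIf P? θ f) → evalPL v θ ≡ true
  lawIf-holds (yes _) _ (h ∷ []) = h
  lawIf-holds (no ¬p) p _        = ⊥-elim (¬p p)

  necLaws D-ruleLaws axiomLaws : ∀ B → □ B ∈ Φ → List Law
  necLaws B m = lawIf (provable? (IH B (depth-< m))) (□ B) λ ⊢B → nec ⊢B , m
  D-ruleLaws B m = lawIf (hasD? L ×-dec provable? (IH (¬ᵐ B) (depth-< m))) (¬ᵐ □ B)
                     λ (hasD , ⊢¬B) → D-rule hasD ⊢¬B , m

  DLaws D4Laws : ∀ B → □ ¬ᵐ B ∈ Φ → List Law
  DLaws B m = lawIf (hasD? L ×-dec □ B ∈? Φ) (¬ᵐ (□ B ∧ᵐ □ ¬ᵐ B))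
                λ (hasD , m′) → axD hasD B , m′ , m
  -- Not an instance of the D axiom over Φ, since □ □ B need not lie in Φ.
  D4Laws (□ B) m = lawIf (hasD? L ×-dec has4? L) (¬ᵐ (□ B ∧ᵐ □ ¬ᵐ □ B))
                     λ (hasD , has4) → D4-theorem hasD has4 B , unneg∈Φ (unbox∈Φ m) , m
  D4Laws _     _ = []

  axiomLaws ⊥ᵐ     m = lawIf (hasP? L) (¬ᵐ □ ⊥ᵐ) λ hasP → axP hasP , m
  axiomLaws (¬ᵐ B) m = DLaws B m ++ D4Laws B m
  axiomLaws (□ B)  m = lawIf (has4? L) (□ B ⇒ □ □ B) λ has4 → ax4 has4 B , unbox∈Φ m , m
  axiomLaws _      _ = []

  lawsAt : ∀ {A} → A ∈ Φ → List Law
  lawsAt {□ B} m = necLaws B m ++ D-ruleLaws B m ++ axiomLaws B m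
  lawsAt _       = []

  Θ : List Law
  Θ = concat (mapWith∈ Φ lawsAt)

  Admissible : (Fm → Bool) → Set
  Admissible v = All (Holds v) Θ

  admissible? : ∀ v → Dec (Admissible v)
  admissible? v = All.all? (λ ℓ → evalPL v (formula ℓ) ≟ᵇ true) Θ

  module _ {v} (adm : Admissible v) where

    boxLawsHold : ∀ {B} (m : □ B ∈ Φ) →
      All (Holds v) (necLaws B m) × All (Holds v) (D-ruleLaws B m) × All (Holds v) (axiomLaws B m)
    boxLawsHold {B} m =
      let necs , rest = ++⁻ (necLaws B m) (lookup-mapWith∈ Φ {f = lawsAt} (concat⁻ adm) m)
      in  necs , ++⁻ (D-ruleLaws B m) rest

    nec-holds : ∀ {B} → □ B ∈ Φ → L ⊢ B → v (□ B) ≡ true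
    nec-holds m ⊢B = lawIf-holds _ ⊢B (proj₁ (boxLawsHold m))

    D-rule-holds : ∀ {B} → HasD L → □ B ∈ Φ → L ⊢ (¬ᵐ B) → v (□ B) ≡ false
    D-rule-holds hasD m ⊢¬B =
      not≡true (lawIf-holds _ (hasD , ⊢¬B) (proj₁ (proj₂ (boxLawsHold m))))

    P-holds : HasP L → □ ⊥ᵐ ∈ Φ → v (□ ⊥ᵐ) ≡ false
    P-holds hasP m = not≡true (lawIf-holds _ hasP (proj₂ (proj₂ (boxLawsHold m))))

    D-holds : ∀ {B} → HasD L → □ B ∈ Φ → □ ¬ᵐ B ∈ Φ →
              v (□ B) ≡ true → v (□ ¬ᵐ B) ≡ true → ⊥
    D-holds {B} hasD mB m¬B ⊨□B ⊨□¬B = not-¬ (cong₂ _&&_ ⊨□B ⊨□¬B) (not≡true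
      (lawIf-holds _ (hasD , mB) (proj₁ (++⁻ (DLaws B m¬B) (proj₂ (proj₂ (boxLawsHold m¬B)))))))

    4-holds : ∀ {B} → Has4 L → □ □ B ∈ Φ → v (□ B) ≡ true → v (□ □ B) ≡ true
    4-holds has4 m = ⇒≡true⁻ (lawIf-holds _ has4 (proj₂ (proj₂ (boxLawsHold m))))

    D4-holds : ∀ {B} → HasD L → Has4 L → □ ¬ᵐ □ B ∈ Φ →
               v (□ B) ≡ true → v (□ ¬ᵐ □ B) ≡ true → ⊥
    D4-holds {B} hasD has4 m ⊨□B ⊨□¬□B = not-¬ (cong₂ _&&_ ⊨□B ⊨□¬□B) (not≡true
      (lawIf-holds _ (hasD , has4) (proj₂ (++⁻ (DLaws (□ B) m) (proj₂ (proj₂ (boxLawsHold m)))))))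

  restrict-agrees : ∀ {v} A → AtomsIn Φ A → evalPL (valuation Φ (restrict Φ v)) A ≡ evalPL v A
  restrict-agrees A atomsA = evalPL-cong A atomsA (valuation-restrict Φ)

  restrict-admissible : ∀ {v} → Admissible v → Admissible (valuation Φ (restrict Φ v))
  restrict-admissible = All.map λ {ℓ} → trans (restrict-agrees (formula ℓ) (atoms ℓ))

  force-admissible : ∀ {F} → IsLFrame L F → (M : Model F) (x : Frame.W F) →
                     Admissible (Model.force M x)
  force-admissible {F} isL M x =
    All.universal (λ ℓ → trans (evalPL-force M x (formula ℓ)) (sound (derivable ℓ) F isL M x)) Θ

  derive : (∀ w → Admissible (valuation Φ w) → evalPL (valuation Φ w) C ≡ true) → L ⊢ C
  derive admissible⇒C = mp* (map formula Θ) (taut C-follows) (map⁺ (All.universal derivable Θ))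
    where
    C-follows : Tautology (map formula Θ ⇒* C)
    C-follows v = ⇒*≡true (map formula Θ) λ hs →
      trans (sym (restrict-agrees C (atomsInΦ (here refl))))
            (admissible⇒C (restrict Φ v) (restrict-admissible (map⁻ hs)))

  module Worlds (u₀ : Vec Bool (length Φ)) (adm₀ : Admissible (valuation Φ u₀)) where

    -- Inadmissible vectors are turned into copies of u₀, so that every vector is a world.
    retract : Vec Bool (length Φ) → Vec Bool (length Φ)
    retract w with admissible? (valuation Φ w)
    ... | yes _ = w
    ... | no  _ = u₀

    ⟦_⟧ : Vec Bool (length Φ) → Fm → Bool
    ⟦ w ⟧ = valuation Φ (retract w)

    admissible : ∀ w → Admissible ⟦ w ⟧
    admissible w with admissible? (valuation Φ w)
    ... | yes adm = adm
    ... | no  _   = adm₀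

    retract-id : ∀ {w} → Admissible (valuation Φ w) → retract w ≡ w
    retract-id {w} adm with admissible? (valuation Φ w)
    ... | yes _    = refl
    ... | no  ¬adm = ⊥-elim (¬adm adm)

    open ValuationFrame L (vec↔fin (length Φ)) u₀ ⟦_⟧

    forced-∈Φ : ∀ x {A} → ⟦ x ⟧ A ≡ true → A ∈ Φ
    forced-∈Φ x = valuation-∈ Φ (retract x)

    counterworld : ∀ {B} → Countermodel L B → AtomsIn Φ B → ∃ λ y → y ⊭ B
    counterworld {B} cm atomsB = y , (begin
      evalPL ⟦ y ⟧ B             ≡⟨ cong (λ w → evalPL (valuation Φ w) B) (retract-id y-admissible) ⟩
      evalPL (valuation Φ y) B   ≡⟨ restrict-agrees B atomsB ⟩
      evalPL (Model.force M z) B ≡⟨ evalPL-force M z B ⟩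
      Model.force M z B          ≡⟨ refutes ⟩
      false                      ∎)
      where
      open ≡-Reasoning
      open Countermodel cm using (isL; refutes) renaming (model to M; world to z)
      y = restrict Φ (Model.force M z)
      y-admissible = restrict-admissible (force-admissible isL M z)

    box-up : ∀ {x E D} → Has4 L → □ E ∈ Φ → D ∈ boxTails E → x ⊨ D → x ⊨ □ E
    box-up {x} {□ F} has4 m (here refl) x⊨D = 4-holds (admissible x) has4 m x⊨D
    box-up {x} {□ F} has4 m (there n)   x⊨D =
      4-holds (admissible x) has4 m (box-up has4 (unbox∈Φ m) n x⊨D)

    boxTail-up : ∀ {x E D} → Has4 L → E ∈ Φ → D ∈ boxTails E → x ⊨ D → x ⊨ E
    boxTail-up {E = □ F} has4 m (here refl) x⊨D = x⊨D
    boxTail-up {E = □ F} has4 m (there n)   x⊨D = box-up has4 m n x⊨D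

    persist-⊭ : ∀ {x y E} → Has4 L → E ∈ Φ → x ⊭ E → Persist x E y
    persist-⊭ {x} has4 m x⊭E = All.tabulate λ n x⊨D → refute x⊭E (boxTail-up {x} has4 m n x⊨D)

    witness : ∀ {E} → □ E ∈ Φ → Witnessed E
    witness {E} m x x⊭□E with IH E (depth-< m)
    ... | inj₁ ⊢E = refute x⊭□E (nec-holds (admissible x) m ⊢E)
    ... | inj₂ cm = let y , y⊭E = counterworld cm (atomsInΦ (unbox∈Φ m)) in
      y , (refute x⊭□E , λ has4 → All.tail (persist-⊭ {x} {y} has4 m x⊭□E)) , y⊭E

    isNPFrame : HasP L → IsNPFrame frame
    isNPFrame hasP x =
      x , (λ x⊨□⊥ → refute (P-holds (admissible x) hasP (forced-∈Φ x x⊨□⊥)) x⊨□⊥) ,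
      λ _ → []

    □-successor : ∀ {x E} → HasD L → x ⊨ □ E → ∃ λ y → y ⊨ E × (Has4 L → Persist x E y)
    □-successor {x} {E} hasD x⊨□E = by-cases _ refl
      where
      m : □ E ∈ Φ
      m = forced-∈Φ x x⊨□E
      by-cases : ∀ b → evalPL ⟦ x ⟧ E ≡ b → ∃ λ y → y ⊨ E × (Has4 L → Persist x E y)
      by-cases true  x⊨E = x , x⊨E , λ _ → persist-refl E
      by-cases false x⊭E with IH (¬ᵐ E) (depth-< m)
      ... | inj₁ ⊢¬E = refute (D-rule-holds (admissible x) hasD m ⊢¬E) x⊨□E
      ... | inj₂ cm  = let y , y⊭¬E = counterworld cm (atomsInΦ (unbox∈Φ m)) in
        y , not≡false y⊭¬E , λ has4 → persist-⊭ {x} {y} has4 (unbox∈Φ m) x⊭E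

    D4-clash : ∀ {x E D} → HasD L → Has4 L → x ⊨ □ ¬ᵐ E → D ∈ boxTails E → x ⊨ D → ⊥
    D4-clash {x} {□ F} hasD has4 x⊨□¬□F n x⊨D =
      D4-holds (admissible x) hasD has4 m (boxTail-up has4 (unneg∈Φ (unbox∈Φ m)) n x⊨D) x⊨□¬□F
      where
      m = forced-∈Φ x x⊨□¬□F

    -- Recursion on ¬¬E: a derivation contradicts x ⊨ □¬E by the D rule, a countermodel refutes E.
    □¬-successor : ∀ {x E} → HasD L → x ⊨ □ ¬ᵐ E →
                   ∃ λ y → y ⊭ E × (Has4 L → Persist x E y)
    □¬-successor {x} {E} hasD x⊨□¬E = from-decision (IH (¬ᵐ ¬ᵐ E) (depth-< m))
      where
      m : □ ¬ᵐ E ∈ Φ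
      m = forced-∈Φ x x⊨□¬E
      from-decision : Decided L (¬ᵐ ¬ᵐ E) → ∃ λ y → y ⊭ E × (Has4 L → Persist x E y)
      from-decision (inj₁ ⊢¬¬E) = refute (D-rule-holds (admissible x) hasD m ⊢¬¬E) x⊨□¬E
      from-decision (inj₂ cm)   = let y , y⊭¬¬E = counterworld cm (atomsInΦ (unneg∈Φ (unbox∈Φ m))) in
        y , not≡true (not≡false y⊭¬¬E) ,
        λ has4 → All.tabulate λ n x⊨D → ⊥-elim (D4-clash {x} hasD has4 x⊨□¬E n x⊨D)

    isNDFrame : HasD L → IsNDFrame frame
    isNDFrame hasD E x = by-cases _ _ refl refl
      where
      by-cases : ∀ b b¬ → ⟦ x ⟧ (□ E) ≡ b → ⟦ x ⟧ (□ ¬ᵐ E) ≡ b¬ →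
                 ∃ λ y → Access E x y × Access (¬ᵐ E) x y
      by-cases true  true  x⊨□E x⊨□¬E =
        ⊥-elim (D-holds (admissible x) hasD (forced-∈Φ x x⊨□E) (forced-∈Φ x x⊨□¬E)
                        x⊨□E x⊨□¬E)
      by-cases true  false x⊨□E x⊭□¬E = let y , y⊨E , x↝y = □-successor hasD x⊨□E in
        y , (const y⊨E , x↝y) , (refute x⊭□¬E , λ _ → [])
      by-cases false true  x⊭□E x⊨□¬E = let y , y⊭E , x↝y = □¬-successor hasD x⊨□¬E in
        y , (refute x⊭□E , x↝y) , (const (cong not y⊭E) , λ _ → [])
      by-cases false false x⊭□E x⊭□¬E =
        x , (refute x⊭□E , λ _ → persist-refl E) , (refute x⊭□¬E , λ _ → [])

    countermodel : evalPL (valuation Φ u₀) C ≡ false → Countermodel L C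
    countermodel u₀⊭C = record
      { frame   = frame
      ; isL     = isLFrame L isNPFrame isNDFrame isTransitive
      ; finite  = _ , vec↔fin (length Φ)
      ; model   = model
      ; world   = u₀
      ; refutes = begin
          force u₀ C                ≡⟨ truth C witness u₀ ⟩
          evalPL ⟦ u₀ ⟧ C            ≡⟨ cong (λ w → evalPL (valuation Φ w) C) (retract-id adm₀) ⟩
          evalPL (valuation Φ u₀) C ≡⟨ u₀⊭C ⟩
          false                     ∎
      }
      where open ≡-Reasoning

  decided : Decided L C
  decided with ∃? (vec↔fin (length Φ))
                  (λ w → admissible? (valuation Φ w) ×-dec evalPL (valuation Φ w) C ≟ᵇ false)
  ... | yes (u₀ , adm₀ , u₀⊭C) = inj₂ (Worlds.countermodel u₀ adm₀ u₀⊭C)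
  ... | no  none = inj₁ (derive λ w adm → ¬-not λ w⊭C → none (w , adm , w⊭C))

decide : ∀ L A → Decided L A
decide L = WF.All.wfRec (On.wellFounded depth <-wellFounded) _ (Decided L)
                        λ C IH → Decide.decided L C (λ B → IH {B})

complete : ∀ L A → ValidFiniteLFrames L A → L ⊢ A
complete L A valid = fromInj₁ (λ cm → ⊥-elim (Countermodel.invalid cm valid)) (decide L A)

theorem3p10 : (L : Logic) (A : Fm) →
    ((L ⊢ A) ⇔ ValidAllLFrames L A) × ((L ⊢ A) ⇔ ValidFiniteLFrames L A)
theorem3p10 L A =
  mk⇔ sound (λ valid → complete L A (λ F _ → valid F)) ,
  mk⇔ (λ ⊢A F _ → sound ⊢A F) (complete L A)
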